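{- Let $G$ and $H$ be da-hypomorphs of a graph or digraph. (a) Either (1) every pair of dacards in their common dadeck (obtained by deleting two distinct vertices) is dapasted isomorphically in $G$ and $H$, or (2) no pair of dacards in their common dadeck is dapasted isomorphically in $G$ and $H$. (b) If (1) holds then $G\cong H$, and if (2) holds then $G\not\cong H$.
   Context: Digraphs are finite, without loops or multiple arcs; for distinct vertices $x,y$ both $xy$ and $yx$ may be arcs (together a biarc); an arc whose reverse is absent is an unpaired arc. A graph is regarded as a digraph in which every edge is a biarc. For a vertex $x$ of a digraph $D$, a vertex $w$ is an out-neighbor (in-neighbor) of $x$ if $xw$ ($wx$) is an unpaired arc, and a strong neighbor if $xw,wx$ are both arcs. The degree triple $\mathrm{dt}_D(x)=(a,b,c)$ consists of the numbers of out-, in- and strong neighbors of $x$. A dacard of $D$ is a pair $(D-x,\mathrm{dt}_D(x))$ with $D-x$ taken up to isomorphism; two dacards are identical if the digraphs are isomorphic and the triples are equal. $\mathrm{Dadeck}(D)$ is the multiset of dacards of $D$; $D$ and $H$ are da-hypomorphs if they have the same dadeck. Dapasting: let $(A,\alpha)$, $(B,\beta)$ be dacards of $G$ obtained by deleting distinct vertices of $G$. A dapasting of them as members of $\mathrm{Dadeck}(G)$ is a digraph $P$ with two distinct non-adjacent vertices $u,v$, $u$ labeled $(e,\alpha)$ and $v$ labeled $(e,\beta)$ (others unlabeled), such that $P-u\cong A$, $P-v\cong B$, and there is $Y\in\{P,P+uv,P+vu,P+uv+vu\}$ ($P+xy$ = $P$ with arc $xy$ added) with $\mathrm{dt}_Y(u)=\alpha$,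 $\mathrm{dt}_Y(v)=\beta$ and $Y$ da-hypomorphic to $G$; any digraph isomorphic to such $Y$ is a completion of $P$. $P$ is a dapasting in $J$ if $J$ is a completion of $P$. Two dapastings are isomorphic if there is a digraph isomorphism between them preserving labels. For da-hypomorphs $G,H$, dacards $A,B$ (of the common dadeck) are dapasted isomorphically in $G$ and $H$ if there are a dapasting of $A,B$ in $G$ and a dapasting of $A,B$ in $H$ (both as members of the common dadeck) which are isomorphic as dapastings. -}

module Defs where

open import Data.Nat using (ℕ; zero; suc; _+_)
open import Data.Bool using (Bool; true; false; _∧_; _∨_; not; if_then_else_)
open import Data.Bool.Properties using (∧-zeroʳ; ∨-identityʳ)
open import Data.Fin using (Fin; zero; suc; punchIn; _≟_)
open import Data.Maybe using (Maybe; just; nothing)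
open import Data.Product using (_×_; _,_; Σ; Σ-syntax)
open import Data.Empty using (⊥-elim)
open import Function using (_∘_)
open import Function.Bundles using (_↔_; Inverse)
open import Relation.Nullary using (¬_; yes; no; does)
open import Relation.Binary.PropositionalEquality using (_≡_; _≢_; refl; cong)

-- A biarc is a pair of arcs xy, yx.  (A graph is a digraph all of whose
-- arcs are paired; it is a special case, so "graph or digraph" is covered.)

record Digraph (n : ℕ) : Set where
  field
    arc      : Fin n → Fin n → Bool
    loopless : ∀ x → arc x x ≡ false
open Digraph public

record _≅_ {n : ℕ} (D E : Digraph n) : Set where
  field
    bij : Fin n ↔ Fin n
    pres : ∀ i j → arc D i j ≡ arc E (Inverse.to bij i) (Inverse.to bij j)
open _≅_ public

_-_ : ∀ {n} → Digraph (suc n) → Fin (suc n) → Digraph n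
arc (D - x) i j = arc D (punchIn x i) (punchIn x j)
loopless (D - x) i = loopless D (punchIn x i)

count : ∀ {n} → (Fin n → Bool) → ℕ
count {zero}  f = 0
count {suc n} f = (if f zero then 1 else 0) + count (f ∘ suc)

Triple : Set
Triple = ℕ × ℕ × ℕ

-- Degree triple (out-, in-, strong-neighbours).
-- w is an out-neighbour of x iff xw is an unpaired arc, an in-neighbour iff
-- wx is an unpaired arc, a strong neighbour iff xw and wx are both arcs.
-- (w ≠ x is automatic by looplessness.)
dt : ∀ {n} → Digraph n → Fin n → Triple
dt D x =
  count (λ w → arc D x w ∧ not (arc D w x)) ,
  count (λ w → arc D w x ∧ not (arc D x w)) ,
  count (λ w → arc D x w ∧ arc D w x)

-- Da-hypomorphy: equality of the multisets of dacards (D - x , dt D x),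
-- i.e. a bijection σ of vertices matching each dacard of D with an
-- identical dacard of E.
DaHypo : ∀ {n} → Digraph (suc n) → Digraph (suc n) → Set
DaHypo {n} D E =
  Σ[ σ ∈ Fin (suc n) ↔ Fin (suc n) ]
    (∀ x → ((D - x) ≅ (E - Inverse.to σ x)) × (dt D x ≡ dt E (Inverse.to σ x)))

-- Completions: Y = P + (b₁ ? uv) + (b₂ ? vu), i.e. Y ranges over
-- {P, P+uv, P+vu, P+uv+vu} as (b₁ , b₂) ranges over Bool × Bool.

private
  both-false : ∀ {n} {u v : Fin n} → u ≢ v → ∀ i →
               (does (i ≟ u) ∧ does (i ≟ v)) ≡ false
  both-false {u = u} {v} u≢v i with i ≟ u
  ... | no _ = refl
  ... | yes refl with i ≟ v
  ...   | yes refl = ⊥-elim (u≢v refl)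
  ...   | no _ = refl

complete : ∀ {n} (P : Digraph n) (u v : Fin n) → u ≢ v → Bool → Bool → Digraph n
arc (complete P u v _ b₁ b₂) i j =
  arc P i j ∨ (b₁ ∧ does (i ≟ u) ∧ does (j ≟ v))
            ∨ (b₂ ∧ does (i ≟ v) ∧ does (j ≟ u))
loopless (complete P u v u≢v b₁ b₂) i
  rewrite loopless P i
        | both-false u≢v i
        | both-false (λ e → u≢v (Relation.Binary.PropositionalEquality.sym e)) i
        | ∧-zeroʳ b₁ | ∧-zeroʳ b₂ = refl

-- Dapasting of the dacards (A , α), (B , β) as members of Dadeck(D),
-- together with the data witnessing that it is a dapasting *in* J
-- (i.e. J is a completion of it).

record DapastingIn {n : ℕ} (D : Digraph (suc n)) (A B : Digraph n) (α β : Triple)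
                   (J : Digraph (suc n)) : Set where
  field
    P        : Digraph (suc n)
    u v      : Fin (suc n)
    u≢v      : u ≢ v
    nonadj₁  : arc P u v ≡ false
    nonadj₂  : arc P v u ≡ false
    cardA    : (P - u) ≅ A
    cardB    : (P - v) ≅ B
    b₁ b₂    : Bool
    dt-u     : dt (complete P u v u≢v b₁ b₂) u ≡ α
    dt-v     : dt (complete P u v u≢v b₁ b₂) v ≡ β
    hypo     : DaHypo (complete P u v u≢v b₁ b₂) D
    isCompl  : J ≅ complete P u v u≢v b₁ b₂
open DapastingIn public

label : ∀ {n} {D : Digraph (suc n)} {A B : Digraph n} {α β : Triple}
          {J : Digraph (suc n)} → DapastingIn D A B α β J → Fin (suc n) → Maybe Triple
label {α = α} {β} p w =
  if does (w ≟ u p) then just α else (if does (w ≟ v p) then just β else nothing)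

DapIso : ∀ {n} {D : Digraph (suc n)} {A B : Digraph n} {α β : Triple}
           {J K : Digraph (suc n)} →
         DapastingIn D A B α β J → DapastingIn D A B α β K → Set
DapIso p q = Σ[ φ ∈ P p ≅ P q ] (∀ w → label q (Inverse.to (bij φ) w) ≡ label p w)

DapastedIso : ∀ {n} (G H : Digraph (suc n)) (x y : Fin (suc n)) → Set
DapastedIso G H x y =
  Σ[ p ∈ DapastingIn G (G - x) (G - y) (dt G x) (dt G y) G ]
  Σ[ q ∈ DapastingIn G (G - x) (G - y) (dt G x) (dt G y) H ]
    DapIso p q

{-# OPTIONS --safe #-}
module Submission where

-- Two dapastings that are isomorphic as labelled digraphs have isomorphic
-- completions. Off the pair {u, v} a completion is the dapasting itself. The
-- arcs between u and v are recovered from the degree triple of u: every other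
-- neighbour of u is already visible, so each of the three counts in the triple
-- pins down one Boolean combination of uv and vu, and together they determine
-- both. Conversely, if G ≅ H, deleting the arcs between x and y in G gives a
-- single dapasting completed both by G and by H. So a pair is dapasted
-- isomorphically exactly when G ≅ H, and G ≅ H is decidable.

open import Defs
open import Data.Nat using (ℕ; suc; _+_)
open import Data.Nat.Properties using (+-0-commutativeMonoid; +-cancelʳ-≡)
open import Data.Bool using (Bool; true; false; _∧_; _∨_; not; if_then_else_)
open import Data.Bool.Properties using (∧-zeroʳ; ∧-identityʳ; ∨-identityʳ) renaming (_≟_ to _≟ᴮ_)
open import Data.Fin using (Fin; zero; suc; _≟_; punchIn)
open import Data.Fin.Properties using (any?; all?; punchInᵢ≢i)
open import Data.Vec using (Vec; []; _∷_; lookup; tabulate)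
open import Data.Vec.Properties using (lookup∘tabulate)
open import Data.Maybe using (just)
open import Data.Product using (_×_; _,_; ∃; proj₁; proj₂)
open import Data.Sum using (_⊎_; inj₁; inj₂)
open import Data.Empty using (⊥-elim)
open import Function using (_∘_)
open import Function.Bundles using (_↔_; Inverse; Injection; mk↔ₛ′)
open import Function.Definitions using (Injective)
open import Function.Properties.Inverse using (↔-refl; ↔-sym; ↔-trans; ↔⇒↣)
open import Relation.Nullary using (¬_; Dec; yes; no; does)
open import Relation.Nullary.Decidable using (_×-dec_; _⊎-dec_; dec-true; dec-false)
open import Relation.Binary.PropositionalEquality
  using (_≡_; _≢_; refl; sym; trans; cong; cong₂; module ≡-Reasoning)
open import Algebra.Properties.CommutativeMonoid.Sum +-0-commutativeMonoid
  using (sum; sum-permute; sum-remove)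

open Inverse using (to; from; strictlyInverseˡ; strictlyInverseʳ)

indicator : Bool → ℕ
indicator b = if b then 1 else 0

indicator-injective : ∀ {a b} → indicator a ≡ indicator b → a ≡ b
indicator-injective {false} {false} _ = refl
indicator-injective {true}  {true}  _ = refl
indicator-injective {false} {true}  ()
indicator-injective {true}  {false} ()

count≡sum : ∀ {n} (f : Fin n → Bool) → count f ≡ sum (indicator ∘ f)
count≡sum {0}     f = refl
count≡sum {suc n} f = cong (indicator (f zero) +_) (count≡sum (f ∘ suc))

count-cong : ∀ {n} {f g : Fin n → Bool} → (∀ w → f w ≡ g w) → count f ≡ count g
count-cong {0}     f≗g = refl
count-cong {suc n} f≗g = cong₂ _+_ (cong indicator (f≗g zero)) (count-cong (f≗g ∘ suc))

count-permute : ∀ {n} (f : Fin n → Bool) (π : Fin n ↔ Fin n) → count f ≡ count (f ∘ to π)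
count-permute f π = begin
  count f                     ≡⟨ count≡sum f ⟩
  sum (indicator ∘ f)         ≡⟨ sum-permute (indicator ∘ f) π ⟩
  sum (indicator ∘ f ∘ to π)  ≡⟨ sym (count≡sum (f ∘ to π)) ⟩
  count (f ∘ to π)            ∎
  where open ≡-Reasoning

count-remove : ∀ {n} (f : Fin (suc n) → Bool) k →
               count f ≡ indicator (f k) + count (f ∘ punchIn k)
count-remove {n} f k = begin
  count f                                            ≡⟨ count≡sum f ⟩
  sum (indicator ∘ f)                                ≡⟨ sum-remove (indicator ∘ f) ⟩
  indicator (f k) + sum (indicator ∘ f ∘ punchIn k)  ≡⟨ cong (indicator (f k) +_) (sym (count≡sum f′)) ⟩
  indicator (f k) + count f′                         ∎
  where
  open ≡-Reasoning
  f′ : Fin n → Bool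
  f′ = f ∘ punchIn k

count-determines-point : ∀ {n} (f g : Fin (suc n) → Bool) k →
                         (∀ w → w ≢ k → f w ≡ g w) → count f ≡ count g → f k ≡ g k
count-determines-point f g k agree count-f≡count-g =
  indicator-injective (+-cancelʳ-≡ (count (f ∘ punchIn k)) _ _ (begin
    indicator (f k) + count (f ∘ punchIn k)  ≡⟨ sym (count-remove f k) ⟩
    count f                                  ≡⟨ count-f≡count-g ⟩
    count g                                  ≡⟨ count-remove g k ⟩
    indicator (g k) + count (g ∘ punchIn k)  ≡⟨ cong (indicator (g k) +_) (count-cong off-k) ⟩
    indicator (g k) + count (f ∘ punchIn k)  ∎))
  where
  open ≡-Reasoning
  off-k : ∀ w → g (punchIn k w) ≡ f (punchIn k w)
  off-k w = sym (agree (punchIn k w) (punchInᵢ≢i k w))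

SameArcs : ∀ {n} → Digraph n → Digraph n → Set
SameArcs D E = ∀ i j → arc D i j ≡ arc E i j

module _ {n : ℕ} where

  SameArcs⇒≅ : {D E : Digraph n} → SameArcs D E → D ≅ E
  SameArcs⇒≅ same = record { bij = ↔-refl ; pres = same }

  ≅-refl : {D : Digraph n} → D ≅ D
  ≅-refl = SameArcs⇒≅ λ _ _ → refl

  ≅-sym : {D E : Digraph n} → D ≅ E → E ≅ D
  ≅-sym {D} {E} φ = record { bij = ↔-sym (bij φ) ; pres = pres-from }
    where
    pres-from : ∀ i j → arc E i j ≡ arc D (from (bij φ) i) (from (bij φ) j)
    pres-from i j = sym (trans (pres φ (from (bij φ) i) (from (bij φ) j))
                               (cong₂ (arc E) (strictlyInverseˡ (bij φ) i) (strictlyInverseˡ (bij φ) j)))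

  ≅-trans : {D E F : Digraph n} → D ≅ E → E ≅ F → D ≅ F
  ≅-trans φ ψ = record { bij = ↔-trans (bij φ) (bij ψ)
                       ; pres = λ i j → trans (pres φ i j) (pres ψ _ _) }

  dt-cong : {D E : Digraph n} → SameArcs D E → ∀ w → dt D w ≡ dt E w
  dt-cong same w =
    cong₂ _,_ (count-cong λ z → cong₂ (λ a b → a ∧ not b) (same w z) (same z w))
   (cong₂ _,_ (count-cong λ z → cong₂ (λ a b → a ∧ not b) (same z w) (same w z))
              (count-cong λ z → cong₂ _∧_ (same w z) (same z w)))

SameArcs⇒DaHypo : ∀ {n} {D E : Digraph (suc n)} → SameArcs D E → DaHypo D E
SameArcs⇒DaHypo {D = D} {E} same =
  ↔-refl , λ z → SameArcs⇒≅ (λ i j → same (punchIn z i) (punchIn z j)) , dt-cong {D = D} {E} same z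

link-injective : ∀ a b a′ b′ →
  a ∧ not b ≡ a′ ∧ not b′ → b ∧ not a ≡ b′ ∧ not a′ → a ∧ b ≡ a′ ∧ b′ → a ≡ a′ × b ≡ b′
link-injective false false false false _ _ _ = refl , refl
link-injective false true  false true  _ _ _ = refl , refl
link-injective true  false true  false _ _ _ = refl , refl
link-injective true  true  true  true  _ _ _ = refl , refl
link-injective false false false true  _ () _
link-injective false false true  false () _ _
link-injective false false true  true  _ _ ()
link-injective false true  false false _ () _
link-injective false true  true  false _ () _
link-injective false true  true  true  _ _ ()
link-injective true  false false false () _ _
link-injective true  false false true  () _ _
link-injective true  false true  true  () _ _
link-injective true  true  false false _ _ ()
link-injective true  true  false true  _ _ ()
link-injective true  true  true  false _ _ ()

module _ {m : ℕ} (C C′ : Digraph (suc m)) (π : Fin (suc m) ↔ Fin (suc m)) (s t : Fin (suc m))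
  (agree : ∀ w → w ≢ t → arc C s w ≡ arc C′ (to π s) (to π w) × arc C w s ≡ arc C′ (to π w) (to π s))
  where

  private
    s′ t′ : Fin (suc m)
    s′ = to π s
    t′ = to π t

  count-link-determines : (op : Bool → Bool → Bool) →
    count (λ w → op (arc C s w) (arc C w s)) ≡ count (λ w → op (arc C′ s′ w) (arc C′ w s′)) →
    op (arc C s t) (arc C t s) ≡ op (arc C′ s′ t′) (arc C′ t′ s′)
  count-link-determines op count≡ = count-determines-point f (g ∘ to π) t agree-op (begin
    count f            ≡⟨ count≡ ⟩
    count g            ≡⟨ count-permute g π ⟩
    count (g ∘ to π)   ∎)
    where
    open ≡-Reasoning
    f g : Fin (suc m) → Bool
    f w = op (arc C s w) (arc C w s)
    g w = op (arc C′ s′ w) (arc C′ w s′)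
    agree-op : ∀ w → w ≢ t → f w ≡ g (to π w)
    agree-op w w≢t = cong₂ op (proj₁ (agree w w≢t)) (proj₂ (agree w w≢t))

  dt-determines-arcs : dt C s ≡ dt C′ s′ →
    arc C s t ≡ arc C′ s′ t′ × arc C t s ≡ arc C′ t′ s′
  dt-determines-arcs dt≡ = link-injective _ _ _ _
    (count-link-determines (λ a b → a ∧ not b) (cong proj₁ dt≡))
    (count-link-determines (λ a b → b ∧ not a) (cong (proj₁ ∘ proj₂) dt≡))
    (count-link-determines _∧_ (cong (proj₂ ∘ proj₂) dt≡))

SamePair : ∀ {n} → Fin n → Fin n → Fin n → Fin n → Set
SamePair u v x y = (x ≡ u × y ≡ v) ⊎ (x ≡ v × y ≡ u)

module _ {n : ℕ} where

  samePair? : (u v x y : Fin n) → Dec (SamePair u v x y)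
  samePair? u v x y = ((x ≟ u) ×-dec (y ≟ v)) ⊎-dec ((x ≟ v) ×-dec (y ≟ u))

  samePair-sym : {u v x y : Fin n} → SamePair u v x y → SamePair x y u v
  samePair-sym (inj₁ (refl , refl)) = inj₁ (refl , refl)
  samePair-sym (inj₂ (refl , refl)) = inj₂ (refl , refl)

  samePair-trans : {u v x y a b : Fin n} → SamePair u v x y → SamePair x y a b → SamePair u v a b
  samePair-trans (inj₁ (refl , refl)) xy~ab = xy~ab
  samePair-trans (inj₂ (refl , refl)) (inj₁ (refl , refl)) = inj₂ (refl , refl)
  samePair-trans (inj₂ (refl , refl)) (inj₂ (refl , refl)) = inj₁ (refl , refl)

  samePair-injective : {f : Fin n → Fin n} → Injective _≡_ _≡_ f →
    {u v x y : Fin n} → SamePair (f u) (f v) (f x) (f y) → SamePair u v x y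
  samePair-injective f-inj (inj₁ (e₁ , e₂)) = inj₁ (f-inj e₁ , f-inj e₂)
  samePair-injective f-inj (inj₂ (e₁ , e₂)) = inj₂ (f-inj e₁ , f-inj e₂)

  module _ (P : Digraph n) {u v : Fin n} (u≢v : u ≢ v) (b₁ b₂ : Bool) where

    private
      C : Digraph n
      C = complete P u v u≢v b₁ b₂

    complete-off : ∀ {x y} → ¬ SamePair u v x y → arc C x y ≡ arc P x y
    complete-off {x} {y} ¬pair
      rewrite dec-false ((x ≟ u) ×-dec (y ≟ v)) (¬pair ∘ inj₁)
            | dec-false ((x ≟ v) ×-dec (y ≟ u)) (¬pair ∘ inj₂)
            | ∧-zeroʳ b₁ | ∧-zeroʳ b₂ = ∨-identityʳ (arc P x y)

    complete-uv : arc C u v ≡ arc P u v ∨ b₁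
    complete-uv
      rewrite dec-true (u ≟ u) refl | dec-true (v ≟ v) refl | dec-false (u ≟ v) u≢v
            | ∧-identityʳ b₁ | ∧-zeroʳ b₂ | ∨-identityʳ b₁ = refl

    complete-vu : arc C v u ≡ arc P v u ∨ b₂
    complete-vu
      rewrite dec-true (u ≟ u) refl | dec-true (v ≟ v) refl | dec-false (v ≟ u) (u≢v ∘ sym)
            | ∧-zeroʳ b₁ | ∧-identityʳ b₂ = refl

module _ {n : ℕ} {D : Digraph (suc n)} {A B : Digraph n} {α β : Triple} where

  completion : ∀ {J} → DapastingIn D A B α β J → Digraph (suc n)
  completion p = complete (P p) (u p) (v p) (u≢v p) (b₁ p) (b₂ p)

  label-u : ∀ {J} (p : DapastingIn D A B α β J) → label p (u p) ≡ just α
  label-u p rewrite dec-true (u p ≟ u p) refl = refl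

  label-v : ∀ {J} (p : DapastingIn D A B α β J) → label p (v p) ≡ just β
  label-v p rewrite dec-false (v p ≟ u p) (u≢v p ∘ sym) | dec-true (v p ≟ v p) refl = refl

  label≡just : ∀ {J} (p : DapastingIn D A B α β J) {w γ} → label p w ≡ just γ →
               (w ≡ u p × α ≡ γ) ⊎ (w ≡ v p × β ≡ γ)
  label≡just p {w} eq with w ≟ u p | w ≟ v p | eq
  ... | yes w≡u | _       | refl = inj₁ (w≡u , refl)
  ... | no _    | yes w≡v | refl = inj₂ (w≡v , refl)
  ... | no _    | no _    | ()

  module _ {J K} (p : DapastingIn D A B α β J) (q : DapastingIn D A B α β K) (p≅q : DapIso p q) where

    private
      φ : P p ≅ P q
      φ = proj₁ p≅q
      labels : ∀ w → label q (to (bij φ) w) ≡ label p w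
      labels = proj₂ p≅q
      π : Fin (suc n) → Fin (suc n)
      π = to (bij φ)
      π-injective : Injective _≡_ _≡_ π
      π-injective = Injection.injective (↔⇒↣ (bij φ))

    ends-matched : SamePair (u q) (v q) (π (u p)) (π (v p)) × dt (completion q) (π (u p)) ≡ α
    ends-matched with label≡just q (trans (labels (u p)) (label-u p))
                    | label≡just q (trans (labels (v p)) (label-v p))
    ... | inj₁ (πu≡u , _)   | inj₂ (πv≡v , _) =
      inj₁ (πu≡u , πv≡v) , trans (cong (dt (completion q)) πu≡u) (dt-u q)
    ... | inj₂ (πu≡v , β≡α) | inj₁ (πv≡u , _) =
      inj₂ (πu≡v , πv≡u) , trans (cong (dt (completion q)) πu≡v) (trans (dt-v q) β≡α)
    ... | inj₁ (πu≡u , _)   | inj₁ (πv≡u , _) = ⊥-elim (u≢v p (π-injective (trans πu≡u (sym πv≡u))))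
    ... | inj₂ (πu≡v , _)   | inj₂ (πv≡v , _) = ⊥-elim (u≢v p (π-injective (trans πu≡v (sym πv≡v))))

    arcs-off-pair : ∀ {x y} → ¬ SamePair (u p) (v p) x y →
                    arc (completion p) x y ≡ arc (completion q) (π x) (π y)
    arcs-off-pair {x} {y} ¬pair = begin
      arc (completion p) x y   ≡⟨ complete-off (P p) (u≢v p) (b₁ p) (b₂ p) ¬pair ⟩
      arc (P p) x y            ≡⟨ pres φ x y ⟩
      arc (P q) (π x) (π y)    ≡⟨ sym (complete-off (P q) (u≢v q) (b₁ q) (b₂ q) ¬pair-q) ⟩
      arc (completion q) (π x) (π y) ∎
      where
      open ≡-Reasoning
      ¬pair-q : ¬ SamePair (u q) (v q) (π x) (π y)
      ¬pair-q pair-q = ¬pair (samePair-injective π-injective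
                               (samePair-trans (samePair-sym (proj₁ ends-matched)) pair-q))

    arcs-on-pair : arc (completion p) (u p) (v p) ≡ arc (completion q) (π (u p)) (π (v p))
                 × arc (completion p) (v p) (u p) ≡ arc (completion q) (π (v p)) (π (u p))
    arcs-on-pair = dt-determines-arcs (completion p) (completion q) (bij φ) (u p) (v p)
      (λ w w≢v → arcs-off-pair (not-out w≢v) , arcs-off-pair (not-in w≢v))
      (trans (dt-u p) (sym (proj₂ ends-matched)))
      where
      not-out : ∀ {w} → w ≢ v p → ¬ SamePair (u p) (v p) (u p) w
      not-out w≢v (inj₁ (_ , w≡v)) = w≢v w≡v
      not-out w≢v (inj₂ (u≡v , _)) = u≢v p u≡v
      not-in : ∀ {w} → w ≢ v p → ¬ SamePair (u p) (v p) w (u p)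
      not-in w≢v (inj₁ (_ , u≡v)) = u≢v p u≡v
      not-in w≢v (inj₂ (w≡v , _)) = w≢v w≡v

    completions-≅ : completion p ≅ completion q
    completions-≅ = record { bij = bij φ ; pres = arcs }
      where
      arcs : ∀ x y → arc (completion p) x y ≡ arc (completion q) (π x) (π y)
      arcs x y with samePair? (u p) (v p) x y
      ... | no ¬pair                = arcs-off-pair ¬pair
      ... | yes (inj₁ (refl , refl)) = proj₁ arcs-on-pair
      ... | yes (inj₂ (refl , refl)) = proj₂ arcs-on-pair

  DapIso⇒≅ : ∀ {J K} (p : DapastingIn D A B α β J) (q : DapastingIn D A B α β K) → DapIso p q → J ≅ K
  DapIso⇒≅ p q p≅q = ≅-trans (isCompl p) (≅-trans (completions-≅ p q p≅q) (≅-sym (isCompl q)))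

disconnect : ∀ {n} → Digraph n → Fin n → Fin n → Digraph n
arc (disconnect G x y) i j = arc G i j ∧ not (does (samePair? x y i j))
loopless (disconnect G x y) i rewrite loopless G i = refl

module _ {n : ℕ} (G : Digraph n) (x y : Fin n) where

  disconnect-off : ∀ {i j} → ¬ SamePair x y i j → arc (disconnect G x y) i j ≡ arc G i j
  disconnect-off {i} {j} ¬pair rewrite dec-false (samePair? x y i j) ¬pair = ∧-identityʳ (arc G i j)

  disconnect-on : ∀ {i j} → SamePair x y i j → arc (disconnect G x y) i j ≡ false
  disconnect-on {i} {j} pair rewrite dec-true (samePair? x y i j) pair = ∧-zeroʳ (arc G i j)

  restore : (x≢y : x ≢ y) → SameArcs (complete (disconnect G x y) x y x≢y (arc G x y) (arc G y x)) G
  restore x≢y i j with samePair? x y i j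
  ... | no ¬pair =
    trans (complete-off (disconnect G x y) x≢y (arc G x y) (arc G y x) ¬pair) (disconnect-off ¬pair)
  ... | yes (inj₁ (refl , refl)) =
    trans (complete-uv (disconnect G x y) x≢y (arc G x y) (arc G y x))
          (cong (_∨ arc G x y) (disconnect-on (inj₁ (refl , refl))))
  ... | yes (inj₂ (refl , refl)) =
    trans (complete-vu (disconnect G x y) x≢y (arc G x y) (arc G y x))
          (cong (_∨ arc G y x) (disconnect-on (inj₂ (refl , refl))))

disconnect-minus : ∀ {n} (G : Digraph (suc n)) {x y z} → z ≡ x ⊎ z ≡ y →
                   SameArcs (disconnect G x y - z) (G - z)
disconnect-minus G {x} {y} {z} z∈xy i j = disconnect-off G x y (avoids z∈xy)
  where
  avoids : z ≡ x ⊎ z ≡ y → ¬ SamePair x y (punchIn z i) (punchIn z j)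
  avoids (inj₁ refl) (inj₁ (e , _)) = punchInᵢ≢i z i e
  avoids (inj₁ refl) (inj₂ (_ , e)) = punchInᵢ≢i z j e
  avoids (inj₂ refl) (inj₁ (_ , e)) = punchInᵢ≢i z j e
  avoids (inj₂ refl) (inj₂ (e , _)) = punchInᵢ≢i z i e

canonical-dapasting : ∀ {n} (G : Digraph (suc n)) {x y} → x ≢ y → ∀ {J} → J ≅ G →
                      DapastingIn G (G - x) (G - y) (dt G x) (dt G y) J
canonical-dapasting {n} G {x} {y} x≢y J≅G = record
  { P = disconnect G x y ; u = x ; v = y ; u≢v = x≢y
  ; nonadj₁ = disconnect-on G x y (inj₁ (refl , refl))
  ; nonadj₂ = disconnect-on G x y (inj₂ (refl , refl))
  ; cardA = SameArcs⇒≅ (disconnect-minus G (inj₁ refl))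
  ; cardB = SameArcs⇒≅ (disconnect-minus G (inj₂ refl))
  ; b₁ = arc G x y ; b₂ = arc G y x
  ; dt-u = dt-cong {D = C} {G} C≐G x
  ; dt-v = dt-cong {D = C} {G} C≐G y
  ; hypo = SameArcs⇒DaHypo {D = C} {G} C≐G
  ; isCompl = ≅-trans J≅G (SameArcs⇒≅ λ i j → sym (C≐G i j))
  }
  where
  C : Digraph (suc n)
  C = complete (disconnect G x y) x y x≢y (arc G x y) (arc G y x)
  C≐G : SameArcs C G
  C≐G = restore G x y x≢y

≅⇒DapastedIso : ∀ {n} {G H : Digraph (suc n)} → G ≅ H → ∀ x y → x ≢ y → DapastedIso G H x y
≅⇒DapastedIso {G = G} G≅H x y x≢y =
  canonical-dapasting G x≢y ≅-refl , canonical-dapasting G x≢y (≅-sym G≅H) , ≅-refl , λ _ → refl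

DapastedIso⇒≅ : ∀ {n} {G H : Digraph (suc n)} {x y} → DapastedIso G H x y → G ≅ H
DapastedIso⇒≅ (p , q , p≅q) = DapIso⇒≅ p q p≅q

∃-vector? : ∀ {m k} (Q : Vec (Fin k) m → Set) → (∀ xs → Dec (Q xs)) → Dec (∃ Q)
∃-vector? {0} Q Q? with Q? []
... | yes q = yes ([] , q)
... | no ¬q = no λ { ([] , q) → ¬q q }
∃-vector? {suc m} Q Q? with any? (λ x → ∃-vector? (Q ∘ (x ∷_)) (Q? ∘ (x ∷_)))
... | yes (x , xs , q) = yes (x ∷ xs , q)
... | no ¬q = no λ { (x ∷ xs , q) → ¬q (x , xs , q) }

module _ {m : ℕ} (G H : Digraph m) where

  IsoVia : (Fin m → Fin m) → (Fin m → Fin m) → Set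
  IsoVia f g = (∀ i → g (f i) ≡ i) × (∀ i → f (g i) ≡ i) × (∀ i j → arc G i j ≡ arc H (f i) (f j))

  isoVia? : ∀ f g → Dec (IsoVia f g)
  isoVia? f g = all? (λ i → g (f i) ≟ i) ×-dec all? (λ i → f (g i) ≟ i)
                ×-dec all? (λ i → all? λ j → arc G i j ≟ᴮ arc H (f i) (f j))

  IsoVia-resp-≗ : ∀ {f f′ g g′} → (∀ i → f′ i ≡ f i) → (∀ i → g′ i ≡ g i) → IsoVia f g → IsoVia f′ g′
  IsoVia-resp-≗ {f} {f′} {g} {g′} f′≗f g′≗g (gf , fg , arcs) =
    (λ i → trans (trans (cong g′ (f′≗f i)) (g′≗g (f i))) (gf i)) ,
    (λ i → trans (trans (cong f′ (g′≗g i)) (f′≗f (g i))) (fg i)) ,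
    (λ i j → trans (arcs i j) (sym (cong₂ (arc H) (f′≗f i) (f′≗f j))))

  ≅⇒IsoVia : (φ : G ≅ H) → IsoVia (to (bij φ)) (from (bij φ))
  ≅⇒IsoVia φ = strictlyInverseʳ (bij φ) , strictlyInverseˡ (bij φ) , pres φ

  _≅?_ : Dec (G ≅ H)
  _≅?_ with ∃-vector? (λ fs → ∃ λ gs → IsoVia (lookup fs) (lookup gs))
                      (λ fs → ∃-vector? _ λ gs → isoVia? (lookup fs) (lookup gs))
  ... | yes (fs , gs , gf , fg , arcs) =
    yes record { bij = mk↔ₛ′ (lookup fs) (lookup gs) fg gf ; pres = arcs }
  ... | no ¬iso = no λ φ → ¬iso (tabulate (to (bij φ)) , tabulate (from (bij φ)) ,
                     IsoVia-resp-≗ (lookup∘tabulate _) (lookup∘tabulate _) (≅⇒IsoVia φ))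

theorem5p11 : ∀ {n : ℕ} (G H : Digraph (suc (suc n))) → DaHypo G H →
    (((∀ (x y : Fin (suc (suc n))) → x ≢ y → DapastedIso G H x y)
       ⊎ (∀ (x y : Fin (suc (suc n))) → x ≢ y → ¬ DapastedIso G H x y))
    × ((∀ (x y : Fin (suc (suc n))) → x ≢ y → DapastedIso G H x y) → G ≅ H)
    × ((∀ (x y : Fin (suc (suc n))) → x ≢ y → ¬ DapastedIso G H x y) → ¬ (G ≅ H)))
theorem5p11 G H _ = dichotomy , all⇒≅ , none⇒≇
  where
  dichotomy : (∀ x y → x ≢ y → DapastedIso G H x y) ⊎ (∀ x y → x ≢ y → ¬ DapastedIso G H x y)
  dichotomy with G ≅? H
  ... | yes G≅H = inj₁ (≅⇒DapastedIso G≅H)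
  ... | no G≇H  = inj₂ λ _ _ _ → G≇H ∘ DapastedIso⇒≅

  all⇒≅ : (∀ x y → x ≢ y → DapastedIso G H x y) → G ≅ H
  all⇒≅ all = DapastedIso⇒≅ (all zero (suc zero) λ ())

  none⇒≇ : (∀ x y → x ≢ y → ¬ DapastedIso G H x y) → ¬ (G ≅ H)
  none⇒≇ none G≅H = none zero (suc zero) (λ ()) (≅⇒DapastedIso G≅H zero (suc zero) λ ())
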